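{- Let $\omega$ be any finite word over the alphabet $\{a,b\}$. Then the cuts $a\omega^Tb\,\vert\, a\omega b$ and $b\omega^Ta\,\vert\, b\omega a$ are good, and the cuts $b\omega^Tb\,\vert\, a\omega a$ and $a\omega^Ta\,\vert\, b\omega b$ are bad.
   Context: Here $a=22$ and $b=11$; a word over $\{a,b\}$ is identified with the word over $\{1,2\}$ obtained by substituting $a\mapsto 22$, $b\mapsto 11$. For a finite word $w=w_1\cdots w_k$, $w^T=w_k\cdots w_1$ is its reversal (reversal over $\{a,b\}$ and over $\{1,2\}$ give the same word). For a bi-infinite word $\cdots x_{i-1}x_i\,\vert\, x_{i+1}x_{i+2}\cdots$ over $\{1,2\}$ with a marked position (a "cut"), its value is $\lambda=[0;x_i,x_{i-1},\dots]+[x_{i+1};x_{i+2},\dots]$. For words over $\{a,b\}$, a cut written $E\,b\,\vert\, a\,F$ is the cut of the $\{1,2\}$-word at the boundary between that $b$ and that $a$, while a cut written $E\,a\,\vert\, b\,F$ means, by convention, the cut between the two letters $2$ of that $a$, i.e. $E\,2\,\vert\,2\,b\,F$. A cut is bad if its value is $>3$ and good otherwise. A cut $E\vert F$ of a finite word ($E,F$ finite words over $\{a,b\}$) is called good (resp. bad) if for every left-infinite word $L$ and right-infinite word $R$ over $\{a,b\}$, the corresponding cut $LE\,\vert\,FR$ of the bi-infinite word is good (resp. bad). -}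

module Defs where

open import Data.Nat using (ℕ; zero; suc; _+_; _*_; _<_; ⌊_/2⌋)
open import Data.List using (List; []; _∷_; _++_; reverse; map; upTo; concatMap)
open import Data.Product using (_×_; _,_; ∃)
open import Relation.Nullary using (¬_)

-- Letters: a = 22, b = 11.
data Letter : Set where
  a b : Letter

digit : Letter → ℕ
digit a = 2
digit b = 1

expand : List Letter → List ℕ
expand = concatMap (λ l → digit l ∷ digit l ∷ [])

-- A one-sided infinite word over {a,b} is a function ℕ → Letter.
-- For a left-infinite word L, L 0 is the letter adjacent to the cut,
-- L 1 the next one further to the left, and so on.
InfWord : Set
InfWord = ℕ → Letter

expandInf : InfWord → ℕ → ℕ
expandInf W n = digit (W ⌊ n /2⌋)

prepend : List ℕ → (ℕ → ℕ) → ℕ → ℕ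
prepend []       s n       = s n
prepend (x ∷ xs) s zero    = x
prepend (x ∷ xs) s (suc n) = prepend xs s n

-- Digits around the cut of E | F (E, F finite words over {a,b}).
-- First component: the digits left of the cut, read outward (x_i, x_{i-1}, ...);
-- second component: the digits right of the cut (x_{i+1}, x_{i+2}, ...).
-- Convention: a cut written  E' a | b F'  is the cut  E' 2 | 2 b F'.
-- The first argument is E reversed.
cutDigitsRev : List Letter → List Letter → List ℕ × List ℕ
cutDigitsRev (a ∷ Er) (b ∷ F) = 2 ∷ expand Er , 2 ∷ expand (b ∷ F)
cutDigitsRev Er       F       = expand Er , expand F

cutDigits : List Letter → List Letter → List ℕ × List ℕ
cutDigits E F = cutDigitsRev (reverse E) F

-- Finite continued fraction [x0; x1, ..., xn] as a pair (numerator, denominator):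
-- frac [] = (1,0) ("∞"), frac (x ∷ xs) = x + 1 / frac xs.
frac : List ℕ → ℕ × ℕ
frac []       = 1 , 0
frac (x ∷ xs) with frac xs
... | p , q = x * p + q , p

takeS : ℕ → (ℕ → ℕ) → List ℕ
takeS m s = map s (upTo m)

-- Value λ = [0; l0, l1, ...] + [r0; r1, ...] of a cut with left digits l
-- (read outward) and right digits r.  Since there are no real numbers in
-- the library, "λ > 3" is expressed through the even-index convergents,
-- which increase strictly to the respective limits:
-- λ > 3  iff  for some k, [0; l0..l_{2k-1}] + [r0; r1..r_{2k}] > 3.
ValueGt3 : (ℕ → ℕ) → (ℕ → ℕ) → Set
ValueGt3 l r = ∃ λ k → Go (frac (0 ∷ takeS (k + k) l)) (frac (takeS (suc (k + k)) r))
  where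
  Go : ℕ × ℕ → ℕ × ℕ → Set
  Go (p₁ , q₁) (p₂ , q₂) = 3 * (q₁ * q₂) < p₁ * q₂ + p₂ * q₁

leftStream : List Letter → List Letter → InfWord → ℕ → ℕ
leftStream E F L with cutDigits E F
... | ls , _ = prepend ls (expandInf L)

rightStream : List Letter → List Letter → InfWord → ℕ → ℕ
rightStream E F R with cutDigits E F
... | _ , rs = prepend rs (expandInf R)

BadCut : List Letter → List Letter → Set
BadCut E F = ∀ (L R : InfWord) → ValueGt3 (leftStream E F L) (rightStream E F R)

GoodCut : List Letter → List Letter → Set
GoodCut E F = ∀ (L R : InfWord) → ¬ ValueGt3 (leftStream E F L) (rightStream E F R)

-- Around its central block each of the four cuts reads  [0; 1, 1, X] + [2; 2, Y]
-- or  [0; 2, X] + [2; 1, 1, Y],  where one of X, Y is the continued fraction of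
-- ω a … and the other that of ω b ….  The first value exceeds 3 iff X < Y, the
-- second iff Y < X.  Since ω expands into pairs of equal digits and
-- x ↦ [d; d, x] is increasing, [ω b …] and [ω a …] compare as [1; 1, …] and
-- [2; 2, …], and [1; 1, …] ≤ 2 < [2; 2, …].  So [ω b …] < [ω a …], which makes
-- the first two cuts good and the last two bad.  The value is only available
-- through its convergents, so the comparison is carried out on truncations: of
-- odd against even length for the good cuts, and just past ω for the bad ones.
module Submission where

open import Defs
open import Data.List using (List; []; _∷_; _++_; _∷ʳ_; reverse; applyUpTo; length)
open import Data.List.Properties using (map-applyUpTo; reverse-++; unfold-reverse; reverse-involutive)
open import Data.Nat using (ℕ; zero; suc; _+_; _*_; _≤_; _<_; z≤n; s≤s; z<s)
open import Data.Nat.Properties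
  using (+-suc; *-zeroʳ; *-identityʳ; ≤-reflexive; ≤-trans; <-≤-trans; ≤⇒≯; m≤m+n; m<m+n;
         +-monoʳ-≤; +-monoʳ-<; +-cancelˡ-<)
open import Data.Nat.Tactic.RingSolver using (solve)
open import Data.Product using (_×_; _,_; proj₁; proj₂; ∃)
open import Function.Base using (_∘_; id)
open import Function.Bundles using (_⇔_; mk⇔; Equivalence)
open import Relation.Binary.Core using (_Preserves_⟶_)
open import Relation.Binary.PropositionalEquality
open import Relation.Nullary using (¬_)

open Equivalence using (to; from)

-- Fractions p/q compared by cross-multiplication, so that frac [] = (1 , 0) acts as ∞.
Cross : (ℕ → ℕ → Set) → ℕ × ℕ → ℕ × ℕ → Set
Cross _∼_ (p , q) (p′ , q′) = (p * q′) ∼ (p′ * q)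

_≼_ : ℕ × ℕ → ℕ × ℕ → Set
_≼_ = Cross _≤_

_≺_ : ℕ × ℕ → ℕ × ℕ → Set
_≺_ = Cross _<_

Sum>3 : ℕ × ℕ → ℕ × ℕ → Set
Sum>3 (p₁ , q₁) (p₂ , q₂) = 3 * (q₁ * q₂) < p₁ * q₂ + p₂ * q₁

FiniteCut>3 : List ℕ → List ℕ → Set
FiniteCut>3 ls rs = Sum>3 (frac (0 ∷ ls)) (frac rs)

≼-∞ : ∀ xs → frac xs ≼ frac []
≼-∞ xs = subst (_≤ 1 * proj₂ (frac xs)) (sym (*-zeroʳ (proj₁ (frac xs)))) z≤n

+-cancelˡ-<-⇔ : ∀ {x y m n} c → x ≡ c + m → y ≡ c + n → (x < y ⇔ m < n)
+-cancelˡ-<-⇔ c refl refl = mk⇔ (+-cancelˡ-< c _ _) (+-monoʳ-< c)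

frac-∷-antitone : ∀ {_∼_} → (∀ c → (c +_) Preserves _∼_ ⟶ _∼_) →
  ∀ x xs ys → Cross _∼_ (frac ys) (frac xs) → Cross _∼_ (frac (x ∷ xs)) (frac (x ∷ ys))
frac-∷-antitone {_∼_} +-mono x xs ys with frac xs | frac ys
... | p , q | p′ , q′ = subst₂ _∼_ (sym lhs) (sym rhs) ∘ +-mono (x * p * p′)
  where
  lhs : (x * p + q) * p′ ≡ x * p * p′ + p′ * q
  lhs = solve (x ∷ p ∷ q ∷ p′ ∷ [])
  rhs : (x * p′ + q′) * p ≡ x * p * p′ + p * q′
  rhs = solve (x ∷ p ∷ q′ ∷ p′ ∷ [])

frac-∷∷-monotone : ∀ {_∼_} → (∀ c → (c +_) Preserves _∼_ ⟶ _∼_) →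
  ∀ x y xs ys → Cross _∼_ (frac xs) (frac ys) → Cross _∼_ (frac (x ∷ y ∷ xs)) (frac (x ∷ y ∷ ys))
frac-∷∷-monotone +-mono x y xs ys =
  frac-∷-antitone +-mono x (y ∷ xs) (y ∷ ys) ∘ frac-∷-antitone +-mono y ys xs

frac-11≼22 : ∀ xs ys → frac (1 ∷ 1 ∷ xs) ≼ frac (2 ∷ 2 ∷ ys)
frac-11≼22 xs ys with frac xs | frac ys
... | p , q | p′ , q′ = ≤-trans (m≤m+n _ _) (≤-reflexive (sym gap))
  where
  gap : (2 * (2 * p′ + q′) + p′) * (1 * p + q)
      ≡ (1 * (1 * p + q) + p) * (2 * p′ + q′) + (p * p′ + 3 * q * p′ + q * q′)
  gap = solve (p ∷ q ∷ p′ ∷ q′ ∷ [])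

frac-11≺22∷ : ∀ y → 0 < y → frac (1 ∷ 1 ∷ []) ≺ frac (2 ∷ 2 ∷ y ∷ [])
frac-11≺22∷ (suc y) _ = <-≤-trans (m<m+n _ z<s) (≤-reflexive (sym (*-identityʳ _)))

-- [0; 1, 1, x] + [2; 2, y] = 3 + (y − x) / ((2x + 1)(2y + 1))
sum>3-11∣22 : ∀ xs ys → FiniteCut>3 (1 ∷ 1 ∷ xs) (2 ∷ 2 ∷ ys) ⇔ frac xs ≺ frac ys
sum>3-11∣22 xs ys with frac xs | frac ys
... | p , q | p′ , q′ =
  +-cancelˡ-<-⇔ (12 * p * p′ + 5 * p * q′ + 6 * q * p′ + 3 * q * q′) lhs rhs
  where
  -- both sides are spelled as frac unfolds, so that they match the goal definitionally
  lhs : 3 * ((1 * (1 * p + q) + p) * (2 * p′ + q′))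
      ≡ 12 * p * p′ + 5 * p * q′ + 6 * q * p′ + 3 * q * q′ + p * q′
  lhs = solve (p ∷ q ∷ p′ ∷ q′ ∷ [])
  rhs : (0 * (1 * (1 * p + q) + p) + (1 * p + q)) * (2 * p′ + q′)
          + (2 * (2 * p′ + q′) + p′) * (1 * (1 * p + q) + p)
      ≡ 12 * p * p′ + 5 * p * q′ + 6 * q * p′ + 3 * q * q′ + p′ * q
  rhs = solve (p ∷ q ∷ p′ ∷ q′ ∷ [])

-- [0; 2, x] + [2; 1, 1, y] = 3 + (x − y) / ((2x + 1)(2y + 1))
sum>3-2∣211 : ∀ xs ys → FiniteCut>3 (2 ∷ xs) (2 ∷ 1 ∷ 1 ∷ ys) ⇔ frac ys ≺ frac xs
sum>3-2∣211 xs ys with frac xs | frac ys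
... | p , q | p′ , q′ =
  +-cancelˡ-<-⇔ (12 * p * p′ + 6 * p * q′ + 5 * q * p′ + 3 * q * q′) lhs rhs
  where
  lhs : 3 * ((2 * p + q) * (1 * (1 * p′ + q′) + p′))
      ≡ 12 * p * p′ + 6 * p * q′ + 5 * q * p′ + 3 * q * q′ + p′ * q
  lhs = solve (p ∷ q ∷ p′ ∷ q′ ∷ [])
  rhs : (0 * (2 * p + q) + p) * (1 * (1 * p′ + q′) + p′)
          + (2 * (1 * (1 * p′ + q′) + p′) + (1 * p′ + q′)) * (2 * p + q)
      ≡ 12 * p * p′ + 6 * p * q′ + 5 * q * p′ + 3 * q * q′ + p * q′
  rhs = solve (p ∷ q ∷ p′ ∷ q′ ∷ [])

Convergents>3 : (ℕ → ℕ) → (ℕ → ℕ) → ℕ → Set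
Convergents>3 l r k = FiniteCut>3 (applyUpTo l (k + k)) (applyUpTo r (suc (k + k)))

takeS≡applyUpTo : ∀ n s → takeS n s ≡ applyUpTo s n
takeS≡applyUpTo n s = map-applyUpTo (λ i → i) s n

Convergents>3-suc : ∀ l r k →
  Convergents>3 l r (suc k) ≡ FiniteCut>3 (applyUpTo l (2 + (k + k))) (applyUpTo r (3 + (k + k)))
Convergents>3-suc l r k = cong (λ n → FiniteCut>3 (applyUpTo l (suc n)) (applyUpTo r (2 + n))) (+-suc k k)

convergents≤3⇒¬valueGt3 : ∀ {l r} → (∀ k → ¬ Convergents>3 l r k) → ¬ ValueGt3 l r
convergents≤3⇒¬valueGt3 {l} {r} ≤3 (k , gt) =
  ≤3 k (subst₂ FiniteCut>3 (takeS≡applyUpTo (k + k) l) (takeS≡applyUpTo (suc (k + k)) r) gt)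

convergent>3⇒valueGt3 : ∀ {l r} → ∃ (Convergents>3 l r) → ValueGt3 l r
convergent>3⇒valueGt3 {l} {r} (k , gt) =
  k , subst₂ FiniteCut>3 (sym (takeS≡applyUpTo (k + k) l)) (sym (takeS≡applyUpTo (suc (k + k)) r)) gt

frac-odd-ωb≼even-ωa : ∀ ω (s t : ℕ → ℕ) m →
  frac (applyUpTo (prepend (expand (ω ++ b ∷ [])) s) (suc (m + m)))
    ≼ frac (applyUpTo (prepend (expand (ω ++ a ∷ [])) t) (m + m))
frac-odd-ωb≼even-ωa ω s t zero = ≼-∞ (applyUpTo (prepend (expand (ω ++ b ∷ [])) s) 1)
frac-odd-ωb≼even-ωa [] s t (suc m) rewrite +-suc m m =
  frac-11≼22 (applyUpTo s (suc (m + m))) (applyUpTo t (m + m))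
frac-odd-ωb≼even-ωa (x ∷ ω) s t (suc m) rewrite +-suc m m =
  frac-∷∷-monotone +-monoʳ-≤ (digit x) (digit x)
    (applyUpTo (prepend (expand (ω ++ b ∷ [])) s) (suc (m + m)))
    (applyUpTo (prepend (expand (ω ++ a ∷ [])) t) (m + m))
    (frac-odd-ωb≼even-ωa ω s t m)

frac-even-ωb≺odd-ωa : ∀ ω (s t : ℕ → ℕ) → 0 < t 0 → let n = suc (length ω) in
  frac (applyUpTo (prepend (expand (ω ++ b ∷ [])) s) (n + n))
    ≺ frac (applyUpTo (prepend (expand (ω ++ a ∷ [])) t) (suc (n + n)))
frac-even-ωb≺odd-ωa [] s t t₀>0 = frac-11≺22∷ (t 0) t₀>0
frac-even-ωb≺odd-ωa (x ∷ ω) s t t₀>0 rewrite +-suc (length ω) (suc (length ω)) =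
  frac-∷∷-monotone +-monoʳ-< (digit x) (digit x)
    (applyUpTo (prepend (expand (ω ++ b ∷ [])) s) (n + n))
    (applyUpTo (prepend (expand (ω ++ a ∷ [])) t) (suc (n + n)))
    (frac-even-ωb≺odd-ωa ω s t t₀>0)
  where n = suc (length ω)

convergents≤3-11∣22 : ∀ ω (s t : ℕ → ℕ) k →
  ¬ Convergents>3 (prepend (1 ∷ 1 ∷ expand (ω ++ a ∷ [])) s)
                  (prepend (2 ∷ 2 ∷ expand (ω ++ b ∷ [])) t) k
convergents≤3-11∣22 ω s t zero (s≤s (s≤s ()))
convergents≤3-11∣22 ω s t (suc j) =
  ≤⇒≯ (frac-odd-ωb≼even-ωa ω t s j)
    ∘ to (sum>3-11∣22 xs ys) ∘ subst id (Convergents>3-suc l r j)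
  where
  l = prepend (1 ∷ 1 ∷ expand (ω ++ a ∷ [])) s
  r = prepend (2 ∷ 2 ∷ expand (ω ++ b ∷ [])) t
  xs = applyUpTo (prepend (expand (ω ++ a ∷ [])) s) (j + j)
  ys = applyUpTo (prepend (expand (ω ++ b ∷ [])) t) (suc (j + j))

convergents≤3-2∣211 : ∀ ω (s t : ℕ → ℕ) k →
  ¬ Convergents>3 (prepend (2 ∷ expand (ω ++ b ∷ [])) s)
                  (prepend (2 ∷ 1 ∷ 1 ∷ expand (ω ++ a ∷ [])) t) k
convergents≤3-2∣211 ω s t zero (s≤s (s≤s ()))
convergents≤3-2∣211 ω s t (suc j) =
  ≤⇒≯ (frac-odd-ωb≼even-ωa ω s t j)
    ∘ to (sum>3-2∣211 xs ys) ∘ subst id (Convergents>3-suc l r j)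
  where
  l = prepend (2 ∷ expand (ω ++ b ∷ [])) s
  r = prepend (2 ∷ 1 ∷ 1 ∷ expand (ω ++ a ∷ [])) t
  xs = applyUpTo (prepend (expand (ω ++ b ∷ [])) s) (suc (j + j))
  ys = applyUpTo (prepend (expand (ω ++ a ∷ [])) t) (j + j)

convergents>3-11∣22 : ∀ ω (s t : ℕ → ℕ) → 0 < t 0 →
  ∃ (Convergents>3 (prepend (1 ∷ 1 ∷ expand (ω ++ b ∷ [])) s)
                    (prepend (2 ∷ 2 ∷ expand (ω ++ a ∷ [])) t))
convergents>3-11∣22 ω s t t₀>0 = suc n ,
  subst id (sym (Convergents>3-suc l r n))
    (from (sum>3-11∣22 xs ys) (frac-even-ωb≺odd-ωa ω s t t₀>0))
  where
  n = suc (length ω)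
  l = prepend (1 ∷ 1 ∷ expand (ω ++ b ∷ [])) s
  r = prepend (2 ∷ 2 ∷ expand (ω ++ a ∷ [])) t
  xs = applyUpTo (prepend (expand (ω ++ b ∷ [])) s) (n + n)
  ys = applyUpTo (prepend (expand (ω ++ a ∷ [])) t) (suc (n + n))

convergents>3-2∣211 : ∀ ω (s t : ℕ → ℕ) → 0 < s 0 →
  ∃ (Convergents>3 (prepend (2 ∷ expand (ω ++ a ∷ [])) s)
                    (prepend (2 ∷ 1 ∷ 1 ∷ expand (ω ++ b ∷ [])) t))
convergents>3-2∣211 ω s t s₀>0 = suc n ,
  subst id (sym (Convergents>3-suc l r n))
    (from (sum>3-2∣211 xs ys) (frac-even-ωb≺odd-ωa ω t s s₀>0))
  where
  n = suc (length ω)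
  l = prepend (2 ∷ expand (ω ++ a ∷ [])) s
  r = prepend (2 ∷ 1 ∷ 1 ∷ expand (ω ++ b ∷ [])) t
  xs = applyUpTo (prepend (expand (ω ++ a ∷ [])) s) (suc (n + n))
  ys = applyUpTo (prepend (expand (ω ++ b ∷ [])) t) (n + n)

digit-positive : ∀ l → 0 < digit l
digit-positive a = z<s
digit-positive b = z<s

reverse-∷-reverse-∷ʳ : ∀ {A : Set} (x y : A) xs → reverse (x ∷ reverse xs ∷ʳ y) ≡ y ∷ xs ∷ʳ x
reverse-∷-reverse-∷ʳ x y xs = begin
  reverse (x ∷ reverse xs ∷ʳ y)      ≡⟨ unfold-reverse x (reverse xs ∷ʳ y) ⟩
  reverse (reverse xs ∷ʳ y) ∷ʳ x     ≡⟨ cong (_∷ʳ x) (reverse-++ (reverse xs) (y ∷ [])) ⟩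
  (y ∷ reverse (reverse xs)) ∷ʳ x    ≡⟨ cong (λ zs → (y ∷ zs) ∷ʳ x) (reverse-involutive xs) ⟩
  y ∷ xs ∷ʳ x                        ∎
  where open ≡-Reasoning

CutValueGt3 : List ℕ × List ℕ → InfWord → InfWord → Set
CutValueGt3 (ls , rs) L R = ValueGt3 (prepend ls (expandInf L)) (prepend rs (expandInf R))

cutDigits-∷-reverse-∷ʳ : ∀ x y ω F → cutDigits (x ∷ reverse ω ∷ʳ y) F ≡ cutDigitsRev (y ∷ ω ∷ʳ x) F
cutDigits-∷-reverse-∷ʳ x y ω F = cong (λ Er → cutDigitsRev Er F) (reverse-∷-reverse-∷ʳ x y ω)

goodCut-∷-reverse-∷ʳ : ∀ x y ω F →
  (∀ L R → ¬ CutValueGt3 (cutDigitsRev (y ∷ ω ∷ʳ x) F) L R) → GoodCut (x ∷ reverse ω ∷ʳ y) F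
goodCut-∷-reverse-∷ʳ x y ω F =
  subst (λ c → ∀ L R → ¬ CutValueGt3 c L R) (sym (cutDigits-∷-reverse-∷ʳ x y ω F))

badCut-∷-reverse-∷ʳ : ∀ x y ω F →
  (∀ L R → CutValueGt3 (cutDigitsRev (y ∷ ω ∷ʳ x) F) L R) → BadCut (x ∷ reverse ω ∷ʳ y) F
badCut-∷-reverse-∷ʳ x y ω F =
  subst (λ c → ∀ L R → CutValueGt3 c L R) (sym (cutDigits-∷-reverse-∷ʳ x y ω F))

proposition2p2 : (ω : List Letter) →
    GoodCut (a ∷ reverse ω ++ b ∷ []) (a ∷ ω ++ b ∷ [])
    × GoodCut (b ∷ reverse ω ++ a ∷ []) (b ∷ ω ++ a ∷ [])
    × BadCut (b ∷ reverse ω ++ b ∷ []) (a ∷ ω ++ a ∷ [])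
    × BadCut (a ∷ reverse ω ++ a ∷ []) (b ∷ ω ++ b ∷ [])
proposition2p2 ω =
    goodCut-∷-reverse-∷ʳ a b ω _ (λ L R →
      convergents≤3⇒¬valueGt3 (convergents≤3-11∣22 ω (expandInf L) (expandInf R)))
  , goodCut-∷-reverse-∷ʳ b a ω _ (λ L R →
      convergents≤3⇒¬valueGt3 (convergents≤3-2∣211 ω (expandInf L) (expandInf R)))
  , badCut-∷-reverse-∷ʳ b b ω _ (λ L R →
      convergent>3⇒valueGt3 (convergents>3-11∣22 ω (expandInf L) (expandInf R) (digit-positive (R 0))))
  , badCut-∷-reverse-∷ʳ a a ω _ (λ L R →
      convergent>3⇒valueGt3 (convergents>3-2∣211 ω (expandInf L) (expandInf R) (digit-positive (L 0))))
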